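{- Let $p$ be a prime and let $R$ be a finite field of characteristic $\ell\neq p$ with $-1\in (R^{\times})^p$ and $|R|\ge (p+1)^4$. Then there exists $a\in R\setminus\{0,1\}$ such that the induced subgraph of $G_R(p)$ on $\{0,1,a\}$ is $K_3$ (in particular $K_3$ is a subgraph of $G_R(p)$).
   Context: $(R^{\times})^p=\{u^p:u\in R^{\times}\}$. $G_R(p)$ is the simple undirected graph with vertex set $R$ in which $a,b$ are adjacent iff $a-b\in (R^{\times})^p$. $K_3$ is the complete graph on $3$ vertices. -}

module Defs where

open import Level using (Level; _⊔_)
open import Algebra.Bundles using (CommutativeRing; Semiring)
open import Data.Nat using (ℕ; zero; suc; _<_)
open import Data.Fin using (Fin)
open import Data.Product using (Σ; ∃; _×_; _,_)
open import Relation.Nullary using (¬_)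
open import Relation.Binary.PropositionalEquality as ≡ using (_≡_)
open import Function.Bundles using (Inverse)

module _ {c ℓ : Level} (R : CommutativeRing c ℓ) where
  open CommutativeRing R
  open import Algebra.Definitions.RawSemiring (Semiring.rawSemiring semiring) using (_^_) renaming (_×_ to _·_)

  IsUnit : Carrier → Set (c ⊔ ℓ)
  IsUnit u = Σ Carrier λ v → u * v ≈ 1#

  IsField : Set (c ⊔ ℓ)
  IsField = (¬ (1# ≈ 0#)) × (∀ x → ¬ (x ≈ 0#) → IsUnit x)

  HasCardinality : ℕ → Set (c ⊔ ℓ)
  HasCardinality n = Inverse (≡.setoid (Fin n)) setoid

  HasCharacteristic : ℕ → Set ℓ
  HasCharacteristic m =
    (0 < m) × (m · 1# ≈ 0#) × (∀ k → 0 < k → k < m → ¬ (k · 1# ≈ 0#))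

  IsUnitPower : ℕ → Carrier → Set (c ⊔ ℓ)
  IsUnitPower p x = Σ Carrier λ u → IsUnit u × (u ^ p ≈ x)

  Adj : ℕ → Carrier → Carrier → Set (c ⊔ ℓ)
  Adj p a b = IsUnitPower p (a - b)

  InducesK3 : ℕ → Carrier → Carrier → Carrier → Set (c ⊔ ℓ)
  InducesK3 p x y z =
    (¬ (x ≈ y)) × (¬ (x ≈ z)) × (¬ (y ≈ z)) ×
    Adj p x y × Adj p x z × Adj p y z

{-# OPTIONS --safe #-}

-- Write q = |F|, H = (F^×)^p and m = |H|. Each fibre of u ↦ u^p on F^× is the zero set of the
-- polynomial u^p - h of degree p, so q - 1 ≤ p·m. Suppose no x has both x and 1 - x in H. For a, b ≠ 0
-- let C(a,b) be the number of x with x ∈ aH and 1 - x ∈ bH. Each x ∉ {0,1} is counted by exactly m²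
-- pairs (a,b), so ΣC = m²(q - 2). Two distinct x, y counted by a common pair determine u = y/x ∈ H ∖ {1}
-- and v = (1 - y)/(1 - x) ∈ H, and x = (1 - v)/(u - v); hence ΣC² ≤ m²(q - 2 + m²). By hypothesis
-- C vanishes on H × H, so it is supported on (q - 1)² - m² pairs, and Cauchy–Schwarz gives
--   m⁴(q - 2)² ≤ ((q - 1)² - m²) · m²(q - 2 + m²),
-- which fails once q ≥ (p + 1)⁴. So some x ∉ {0,1} has x, 1 - x ∈ H, and as -1 ∈ H the vertices
-- 0, 1, 1 - x form a triangle.

module Submission where

open import Level using (Level; _⊔_)
open import Algebra.Bundles using (CommutativeRing; Semiring)
open import Data.Empty using (⊥; ⊥-elim)
open import Data.Fin as Fin using (Fin)
import Data.Fin.Properties as Finₚ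
open import Data.Nat as ℕ using (ℕ; zero; suc; _≤_; z≤n; s≤s)
open import Data.Nat.Properties using (≤-trans; ≤-reflexive; module ≤-Reasoning)
import Data.Nat.Properties as ℕₚ
open import Data.Nat.Primality using (Prime; ¬prime[0])
open import Data.Product using (Σ; ∃; _×_; _,_; proj₁; proj₂)
open import Data.Sum using (_⊎_; inj₁; inj₂; [_,_]′)
open import Data.Unit using (tt)
open import Data.Vec using (Vec; []; _∷_)
open import Function using (_∘_)
open import Function.Bundles using (Inverse)
open import Relation.Binary using (Setoid; _Respects_)
open import Relation.Binary.PropositionalEquality as ≡ using (_≡_)
import Relation.Binary.Reasoning.Setoid
open import Relation.Nullary using (¬_; Dec; yes; no; does; contradiction)
open import Relation.Nullary.Decidable using (map′; _×-dec_; ¬?)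
open import Relation.Unary using (Pred; Decidable)
open import Defs

module Counting where

  open import Data.Bool using (if_then_else_)
  open import Data.Nat using (_+_; _*_; _∸_)
  open import Data.Nat.Properties
    using (+-mono-≤; m≤m+n; m≤n+m; m≤m*n; m≤n*m; ≤-total; +-comm; *-comm; *-zeroʳ; *-identityʳ;
           +-identityʳ; m+[n∸m]≡n; *-cancelˡ-≤)
  open import Data.Nat.Tactic.RingSolver using (solve-∀)
  open import Algebra.Properties.Semiring.Sum ℕₚ.+-*-semiring
    using (sum; ∑-distrib-+; ∑-comm; *-distribˡ-sum; *-distribʳ-sum; sum-cong-≗; sum-replicate-zero)

  𝟙 : ∀ {a} {A : Set a} → Dec A → ℕ
  𝟙 A? = if does A? then 1 else 0

  𝟙≤1 : ∀ {a} {A : Set a} (A? : Dec A) → 𝟙 A? ≤ 1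
  𝟙≤1 (yes _) = s≤s z≤n
  𝟙≤1 (no _) = z≤n

  𝟙-no : ∀ {a} {A : Set a} (A? : Dec A) → ¬ A → 𝟙 A? ≡ 0
  𝟙-no (yes a) ¬a = contradiction a ¬a
  𝟙-no (no _) _ = ≡.refl

  𝟙≡0⇒¬ : ∀ {a} {A : Set a} (A? : Dec A) → 𝟙 A? ≡ 0 → ¬ A
  𝟙≡0⇒¬ (yes _) ()
  𝟙≡0⇒¬ (no ¬a) _ = ¬a

  𝟙-mono : ∀ {a b} {A : Set a} {B : Set b} (A? : Dec A) (B? : Dec B) → (A → B) → 𝟙 A? ≤ 𝟙 B?
  𝟙-mono (yes _) (yes _) _ = s≤s z≤n
  𝟙-mono (yes a) (no ¬b) A⇒B = contradiction (A⇒B a) ¬b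
  𝟙-mono (no _) _ _ = z≤n

  𝟙-cong : ∀ {a b} {A : Set a} {B : Set b} (A? : Dec A) (B? : Dec B) → (A → B) → (B → A) → 𝟙 A? ≡ 𝟙 B?
  𝟙-cong (yes _) (yes _) _ _ = ≡.refl
  𝟙-cong (yes a) (no ¬b) A⇒B _ = contradiction (A⇒B a) ¬b
  𝟙-cong (no ¬a) (yes b) _ B⇒A = contradiction (B⇒A b) ¬a
  𝟙-cong (no _) (no _) _ _ = ≡.refl

  𝟙-× : ∀ {a b} {A : Set a} {B : Set b} (A? : Dec A) (B? : Dec B) → 𝟙 (A? ×-dec B?) ≡ 𝟙 A? * 𝟙 B?
  𝟙-× (yes _) (yes _) = ≡.refl
  𝟙-× (yes _) (no _) = ≡.refl
  𝟙-× (no _) _ = ≡.refl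

  𝟙-⊎ : ∀ {a b c} {A : Set a} {B : Set b} {C : Set c} (A? : Dec A) (B? : Dec B) (C? : Dec C) →
    (A → B ⊎ C) → 𝟙 A? ≤ 𝟙 B? + 𝟙 C?
  𝟙-⊎ (no _) _ _ _ = z≤n
  𝟙-⊎ (yes a) B? C? A⇒B⊎C with A⇒B⊎C a
  ... | inj₁ b = ≤-trans (𝟙-mono (yes a) B? (λ _ → b)) (m≤m+n (𝟙 B?) (𝟙 C?))
  ... | inj₂ c = ≤-trans (𝟙-mono (yes a) C? (λ _ → c)) (m≤n+m (𝟙 C?) (𝟙 B?))

  𝟙-split : ∀ {a b} {A : Set a} {B : Set b} (A? : Dec A) (B? : Dec B) → (B → A) →
    𝟙 B? + 𝟙 (A? ×-dec ¬? B?) ≡ 𝟙 A?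
  𝟙-split (yes _) (yes _) _ = ≡.refl
  𝟙-split (yes _) (no _) _ = ≡.refl
  𝟙-split (no ¬a) (yes b) B⇒A = contradiction (B⇒A b) ¬a
  𝟙-split (no _) (no _) _ = ≡.refl

  sum-mono-≤ : ∀ {k} {f g : Fin k → ℕ} → (∀ i → f i ≤ g i) → sum f ≤ sum g
  sum-mono-≤ {zero} f≤g = z≤n
  sum-mono-≤ {suc k} f≤g = +-mono-≤ (f≤g Fin.zero) (sum-mono-≤ (f≤g ∘ Fin.suc))

  sum-δ : ∀ {k} (i : Fin k) → sum (λ j → 𝟙 (j Finₚ.≟ i)) ≡ 1
  sum-δ {suc k} Fin.zero = ≡.cong suc (sum-replicate-zero k)
  sum-δ {suc k} (Fin.suc i) = sum-δ i

  sum-1 : ∀ k → sum {k} (λ _ → 1) ≡ k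
  sum-1 zero = ≡.refl
  sum-1 (suc k) = ≡.cong suc (sum-1 k)

  2xy≤x²+y² : ∀ x y → 2 * (x * y) ≤ x * x + y * y
  2xy≤x²+y² x y = [ ordered , (λ y≤x → ≡.subst₂ _≤_ (≡.cong (2 *_) (*-comm y x)) (+-comm (y * y) (x * x))
                                                    (ordered y≤x)) ]′ (≤-total x y)
    where
    expand : ∀ x d → 2 * (x * (x + d)) + d * d ≡ x * x + (x + d) * (x + d)
    expand = solve-∀
    ordered : ∀ {x y} → x ≤ y → 2 * (x * y) ≤ x * x + y * y
    ordered {x} {y} x≤y = ≡.subst (λ y → 2 * (x * y) ≤ x * x + y * y) (m+[n∸m]≡n x≤y)
                            (≤-trans (m≤m+n _ _) (≤-reflexive (expand x (y ∸ x))))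

  2xy≤x²v+uy² : ∀ x y u v → (u ≡ 0 → x ≡ 0) → (v ≡ 0 → y ≡ 0) →
    2 * (x * y) ≤ x * x * v + u * (y * y)
  2xy≤x²v+uy² x y zero v u≡0⇒x≡0 _ rewrite u≡0⇒x≡0 ≡.refl = z≤n
  2xy≤x²v+uy² x y u zero _ v≡0⇒y≡0 rewrite v≡0⇒y≡0 ≡.refl | *-zeroʳ x = z≤n
  2xy≤x²v+uy² x y u@(suc _) v@(suc _) _ _ =
    ≤-trans (2xy≤x²+y² x y) (+-mono-≤ (m≤m*n (x * x) v) (m≤n*m (y * y) u))

  [am][bm]≡mm[ab] : ∀ a b m → a * m * (b * m) ≡ m * m * (a * b)
  [am][bm]≡mm[ab] = solve-∀

  [ab][cd]≡[ac][bd] : ∀ a b c d → a * b * (c * d) ≡ a * c * (b * d)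
  [ab][cd]≡[ac][bd] = solve-∀

  module FiniteSetoid {c ℓ} (S : Setoid c ℓ) {n : ℕ} (enum : Inverse (≡.setoid (Fin n)) S) where
    open Setoid S
    open Inverse enum using (to; from; from-cong; strictlyInverseˡ; strictlyInverseʳ)

    from-injective : ∀ {x y} → from x ≡ from y → x ≈ y
    from-injective {x} {y} eq =
      trans (sym (strictlyInverseˡ x)) (trans (reflexive (≡.cong to eq)) (strictlyInverseˡ y))

    to-injective : ∀ {i j} → to i ≈ to j → i ≡ j
    to-injective {i} {j} eq =
      ≡.trans (≡.sym (strictlyInverseʳ i)) (≡.trans (from-cong eq) (strictlyInverseʳ j))

    infix 4 _≟_
    _≟_ : ∀ x y → Dec (x ≈ y)
    x ≟ y = map′ from-injective from-cong (from x Finₚ.≟ from y)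

    any? : ∀ {p} {P : Pred Carrier p} → P Respects _≈_ → Decidable P → Dec (∃ P)
    any? resp P? = map′ (λ (i , Pi) → to i , Pi)
                        (λ (x , Px) → from x , resp (sym (strictlyInverseˡ x)) Px)
                        (Finₚ.any? (P? ∘ to))

    ∑ : (Carrier → ℕ) → ℕ
    ∑ f = sum (f ∘ to)

    count : ∀ {p} {P : Pred Carrier p} → Decidable P → ℕ
    count P? = ∑ (𝟙 ∘ P?)

    ∑-cong : ∀ {f g : Carrier → ℕ} → (∀ x → f x ≡ g x) → ∑ f ≡ ∑ g
    ∑-cong f≗g = sum-cong-≗ (f≗g ∘ to)

    ∑-mono-≤ : ∀ {f g : Carrier → ℕ} → (∀ x → f x ≤ g x) → ∑ f ≤ ∑ g
    ∑-mono-≤ f≤g = sum-mono-≤ (f≤g ∘ to)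

    ∑-+ : ∀ (f g : Carrier → ℕ) → ∑ (λ x → f x + g x) ≡ ∑ f + ∑ g
    ∑-+ f g = ∑-distrib-+ (f ∘ to) (g ∘ to)

    *-distribˡ-∑ : ∀ k (f : Carrier → ℕ) → k * ∑ f ≡ ∑ (λ x → k * f x)
    *-distribˡ-∑ k f = *-distribˡ-sum k (f ∘ to)

    *-distribʳ-∑ : ∀ k (f : Carrier → ℕ) → ∑ f * k ≡ ∑ (λ x → f x * k)
    *-distribʳ-∑ k f = *-distribʳ-sum k (f ∘ to)

    ∑-swap : ∀ (f : Carrier → Carrier → ℕ) → ∑ (λ x → ∑ (f x)) ≡ ∑ (λ y → ∑ (λ x → f x y))
    ∑-swap f = ∑-comm (λ i j → f (to i) (to j))

    ∑*∑ : ∀ (f g : Carrier → ℕ) → ∑ f * ∑ g ≡ ∑ (λ x → ∑ (λ y → f x * g y))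
    ∑*∑ f g = ≡.trans (*-distribʳ-∑ (∑ g) f) (∑-cong (λ x → *-distribˡ-∑ (f x) g))

    ∑-1 : ∑ (λ _ → 1) ≡ n
    ∑-1 = sum-1 n

    count-≈ : ∀ x → count (_≟ x) ≡ 1
    count-≈ x = ≡.trans (sum-cong-≗ (λ j → ≡.cong (λ i → 𝟙 (i Finₚ.≟ from x)) (strictlyInverseʳ j)))
                        (sum-δ (from x))

    count-∅ : ∀ {p} {P : Pred Carrier p} (P? : Decidable P) → (∀ x → ¬ P x) → count P? ≡ 0
    count-∅ P? ∄P = ≡.trans (∑-cong (λ x → 𝟙-no (P? x) (∄P x))) (sum-replicate-zero n)

    count-mono : ∀ {p q} {P : Pred Carrier p} {Q : Pred Carrier q} (P? : Decidable P) (Q? : Decidable Q) →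
      (∀ {x} → P x → Q x) → count P? ≤ count Q?
    count-mono P? Q? P⇒Q = ∑-mono-≤ (λ x → 𝟙-mono (P? x) (Q? x) P⇒Q)

    1≤count : ∀ {p} {P : Pred Carrier p} → P Respects _≈_ → (P? : Decidable P) → ∀ {x} → P x → 1 ≤ count P?
    1≤count resp P? {x} Px =
      ≤-trans (≤-reflexive (≡.sym (count-≈ x))) (count-mono (_≟ x) P? (λ y≈x → resp (sym y≈x) Px))

    count-subsingleton : ∀ {p} {P : Pred Carrier p} (P? : Decidable P) →
      (∀ {x y} → P x → P y → x ≈ y) → count P? ≤ 1
    count-subsingleton P? unique with Finₚ.any? (P? ∘ to)
    ... | yes (i , Pi) =
      ≤-trans (sum-mono-≤ (λ j → 𝟙-mono (P? (to j)) (j Finₚ.≟ i) (λ Pj → to-injective (unique Pj Pi))))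
              (≤-reflexive (sum-δ i))
    ... | no ∄P =
      ≤-trans (≤-reflexive (≡.trans (sum-cong-≗ (λ i → 𝟙-no (P? (to i)) (λ Pi → ∄P (i , Pi))))
                                    (sum-replicate-zero n)))
              z≤n

    count-≤-via-injection : ∀ {p q r} {P : Pred Carrier p} {Q : Pred Carrier q}
      {R : Carrier → Carrier → Set r} (P? : Decidable P) (Q? : Decidable Q) (R? : ∀ x y → Dec (R x y)) →
      Q Respects _≈_ → (∀ {x} → R x Respects _≈_) →
      (∀ {x} → P x → ∃ λ y → Q y × R x y) → (∀ {x x′ y} → R x y → R x′ y → x ≈ x′) →
      count P? ≤ count Q?
    count-≤-via-injection P? Q? R? Q-resp R-resp image unique = begin
      ∑ (λ x → 𝟙 (P? x))                        ≤⟨ ∑-mono-≤ hit ⟩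
      ∑ (λ x → ∑ (λ y → 𝟙 (Q? y ×-dec R? x y)))  ≡⟨ ∑-swap (λ x y → 𝟙 (Q? y ×-dec R? x y)) ⟩
      ∑ (λ y → ∑ (λ x → 𝟙 (Q? y ×-dec R? x y)))  ≤⟨ ∑-mono-≤ preimage ⟩
      ∑ (λ y → 𝟙 (Q? y))                        ∎
      where
      open ≤-Reasoning
      hit : ∀ x → 𝟙 (P? x) ≤ ∑ (λ y → 𝟙 (Q? y ×-dec R? x y))
      hit x with P? x
      ... | no _ = z≤n
      ... | yes Px with image Px
      ...   | y , Qy , Rxy = 1≤count (λ y≈y′ (Qy , Rxy) → Q-resp y≈y′ Qy , R-resp y≈y′ Rxy)
                                     (λ y → Q? y ×-dec R? x y) (Qy , Rxy)
      preimage : ∀ y → ∑ (λ x → 𝟙 (Q? y ×-dec R? x y)) ≤ 𝟙 (Q? y)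
      preimage y with Q? y
      ... | Q?y@(yes _) =
        count-subsingleton (λ x → Q?y ×-dec R? x y) (λ (_ , Rxy) (_ , Rx′y) → unique Rxy Rx′y)
      ... | Q?y@(no ¬Qy) = ≤-reflexive (count-∅ (λ x → Q?y ×-dec R? x y) (λ x (Qy , _) → ¬Qy Qy))

    count-fibres : ∀ {p} {P : Pred Carrier p} (P? : Decidable P) (φ : Carrier → Carrier) →
      count P? ≡ ∑ (λ y → count (λ x → P? x ×-dec (y ≟ φ x)))
    count-fibres P? φ = begin
      ∑ (λ x → 𝟙 (P? x))
        ≡⟨ ∑-cong (λ x → *-identityʳ (𝟙 (P? x))) ⟨
      ∑ (λ x → 𝟙 (P? x) * 1)
        ≡⟨ ∑-cong (λ x → ≡.cong (𝟙 (P? x) *_) (count-≈ (φ x))) ⟨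
      ∑ (λ x → 𝟙 (P? x) * count (_≟ φ x))
        ≡⟨ ∑-cong (λ x → *-distribˡ-∑ (𝟙 (P? x)) (λ y → 𝟙 (y ≟ φ x))) ⟩
      ∑ (λ x → ∑ (λ y → 𝟙 (P? x) * 𝟙 (y ≟ φ x)))
        ≡⟨ ∑-cong (λ x → ∑-cong (λ y → ≡.sym (𝟙-× (P? x) (y ≟ φ x)))) ⟩
      ∑ (λ x → ∑ (λ y → 𝟙 (P? x ×-dec (y ≟ φ x))))
        ≡⟨ ∑-swap (λ x y → 𝟙 (P? x ×-dec (y ≟ φ x))) ⟩
      ∑ (λ y → count (λ x → P? x ×-dec (y ≟ φ x)))
        ∎
      where open ≡.≡-Reasoning

    ∑₂ : (Carrier → Carrier → ℕ) → ℕ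
    ∑₂ f = ∑ (λ a → ∑ (f a))

    ∑₂-cong : ∀ {f g : Carrier → Carrier → ℕ} → (∀ a b → f a b ≡ g a b) → ∑₂ f ≡ ∑₂ g
    ∑₂-cong f≗g = ∑-cong (λ a → ∑-cong (f≗g a))

    ∑₂-mono-≤ : ∀ {f g : Carrier → Carrier → ℕ} → (∀ a b → f a b ≤ g a b) → ∑₂ f ≤ ∑₂ g
    ∑₂-mono-≤ f≤g = ∑-mono-≤ (λ a → ∑-mono-≤ (f≤g a))

    ∑₂-+ : ∀ (f g : Carrier → Carrier → ℕ) → ∑₂ (λ a b → f a b + g a b) ≡ ∑₂ f + ∑₂ g
    ∑₂-+ f g = ≡.trans (∑-cong (λ a → ∑-+ (f a) (g a))) (∑-+ (λ a → ∑ (f a)) (λ a → ∑ (g a)))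

    *-distribˡ-∑₂ : ∀ k (f : Carrier → Carrier → ℕ) → k * ∑₂ f ≡ ∑₂ (λ a b → k * f a b)
    *-distribˡ-∑₂ k f = ≡.trans (*-distribˡ-∑ k (λ a → ∑ (f a))) (∑-cong (λ a → *-distribˡ-∑ k (f a)))

    *-distribʳ-∑₂ : ∀ k (f : Carrier → Carrier → ℕ) → ∑₂ f * k ≡ ∑₂ (λ a b → f a b * k)
    *-distribʳ-∑₂ k f = ≡.trans (*-distribʳ-∑ k (λ a → ∑ (f a))) (∑-cong (λ a → *-distribʳ-∑ k (f a)))

    ∑₂*∑₂ : ∀ (f g : Carrier → Carrier → ℕ) → ∑₂ f * ∑₂ g ≡ ∑₂ (λ a b → ∑₂ (λ c d → f a b * g c d))
    ∑₂*∑₂ f g = ≡.trans (*-distribʳ-∑₂ (∑₂ g) f) (∑₂-cong (λ a b → *-distribˡ-∑₂ (f a b) g))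

    ∑₂-swap-∑ : ∀ (F : Carrier → Carrier → Carrier → ℕ) →
      ∑₂ (λ a b → ∑ (F a b)) ≡ ∑ (λ x → ∑₂ (λ a b → F a b x))
    ∑₂-swap-∑ F = ≡.trans (∑-cong (λ a → ∑-swap (F a))) (∑-swap (λ a x → ∑ (λ b → F a b x)))

    ∑₂-swap : ∀ (F : Carrier → Carrier → Carrier → Carrier → ℕ) →
      ∑₂ (λ a b → ∑₂ (F a b)) ≡ ∑₂ (λ x y → ∑₂ (λ a b → F a b x y))
    ∑₂-swap F =
      ≡.trans (∑₂-swap-∑ (λ a b x → ∑ (F a b x))) (∑-cong (λ x → ∑₂-swap-∑ (λ a b → F a b x)))

    cauchy-schwarz : ∀ (f w : Carrier → Carrier → ℕ) → (∀ a b → w a b ≡ 0 → f a b ≡ 0) →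
      ∑₂ f * ∑₂ f ≤ ∑₂ w * ∑₂ (λ a b → f a b * f a b)
    cauchy-schwarz f w supported = *-cancelˡ-≤ 2 (begin
      2 * (∑₂ f * ∑₂ f)
        ≡⟨ ≡.cong (2 *_) (∑₂*∑₂ f f) ⟩
      2 * ∑₂ (λ a b → ∑₂ (λ c d → f a b * f c d))
        ≡⟨ *-distribˡ-∑₂ 2 (λ a b → ∑₂ (λ c d → f a b * f c d)) ⟩
      ∑₂ (λ a b → 2 * ∑₂ (λ c d → f a b * f c d))
        ≡⟨ ∑₂-cong (λ a b → *-distribˡ-∑₂ 2 (λ c d → f a b * f c d)) ⟩
      ∑₂ (λ a b → ∑₂ (λ c d → 2 * (f a b * f c d)))
        ≤⟨ ∑₂-mono-≤ (λ a b → ∑₂-mono-≤ (λ c d →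
             2xy≤x²v+uy² (f a b) (f c d) (w a b) (w c d) (supported a b) (supported c d))) ⟩
      ∑₂ (λ a b → ∑₂ (λ c d → f² a b * w c d + w a b * f² c d))
        ≡⟨ ∑₂-cong (λ a b → ∑₂-+ (λ c d → f² a b * w c d) (λ c d → w a b * f² c d)) ⟩
      ∑₂ (λ a b → ∑₂ (λ c d → f² a b * w c d) + ∑₂ (λ c d → w a b * f² c d))
        ≡⟨ ∑₂-+ (λ a b → ∑₂ (λ c d → f² a b * w c d)) (λ a b → ∑₂ (λ c d → w a b * f² c d)) ⟩
      ∑₂ (λ a b → ∑₂ (λ c d → f² a b * w c d)) + ∑₂ (λ a b → ∑₂ (λ c d → w a b * f² c d))
        ≡⟨ ≡.cong₂ _+_ (∑₂*∑₂ f² w) (∑₂*∑₂ w f²) ⟨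
      ∑₂ f² * ∑₂ w + ∑₂ w * ∑₂ f²
        ≡⟨ ≡.cong (_+ ∑₂ w * ∑₂ f²) (*-comm (∑₂ f²) (∑₂ w)) ⟩
      ∑₂ w * ∑₂ f² + ∑₂ w * ∑₂ f²
        ≡⟨ ≡.cong (∑₂ w * ∑₂ f² +_) (+-identityʳ (∑₂ w * ∑₂ f²)) ⟨
      2 * (∑₂ w * ∑₂ f²) ∎)
      where
      open ≤-Reasoning
      f² : Carrier → Carrier → ℕ
      f² a b = f a b * f a b

module Arithmetic where

  open import Data.Nat using (_+_; _*_; _^_; _<_; s≤s⁻¹)
  open import Data.Nat.Properties
    using (m≤m+n; *-cancelˡ-≤; *-comm; *-assoc; +-comm; *-distribʳ-+; <-irrefl; n<1+n; +-monoˡ-≤; +-monoʳ-<;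
           +-mono-<-≤; *-mono-≤; *-monoʳ-≤; *-monoʳ-<; +-cancelʳ-<)
  open import Data.Nat.Tactic.RingSolver using (solve-∀)

  p³+p≤m : ∀ p m Q → (p + 1) ^ 4 ≤ suc Q → Q ≤ m * p → p * p * p + p ≤ m
  p³+p≤m zero m Q _ _ = z≤n
  p³+p≤m p@(suc _) m Q big Q≤mp =
    ≤-trans (m≤m+n (p * p * p + p) (4 * (p * p) + 5 * p + 4)) (*-cancelˡ-≤ p (begin
      p * (p * p * p + p + (4 * (p * p) + 5 * p + 4))
        ≤⟨ s≤s⁻¹ (≤-trans (≤-reflexive (≡.sym (expand p))) big) ⟩
      Q      ≤⟨ Q≤mp ⟩
      m * p  ≡⟨ *-comm m p ⟩
      p * m  ∎))
    where
    open ≤-Reasoning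
    expand : ∀ q → (q + 1) * ((q + 1) * ((q + 1) * ((q + 1) * 1))) ≡
                   1 + q * (q * q * q + q + (4 * (q * q) + 5 * q + 4))
    expand = solve-∀

  Q²X+m²Q<m⁴ : ∀ {p m X} → suc X ≤ m * p → p * p * p + p ≤ m →
    suc X * suc X * X + m * m * suc X < m * m * (m * m)
  Q²X+m²Q<m⁴ {p} {m} {X} Q≤mp m≥p³+p = begin-strict
    Q * Q * X + m * m * Q
      <⟨ +-mono-<-≤ (*-monoʳ-< (Q * Q) (n<1+n X)) (*-monoʳ-≤ (m * m) Q≤mp) ⟩
    Q * Q * Q + m * m * (m * p)
      ≤⟨ +-monoˡ-≤ (m * m * (m * p)) (*-mono-≤ (*-mono-≤ Q≤mp Q≤mp) Q≤mp) ⟩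
    m * p * (m * p) * (m * p) + m * m * (m * p) ≡⟨ factor m p ⟩
    m * m * m * (p * p * p + p)                 ≤⟨ *-monoʳ-≤ (m * m * m) m≥p³+p ⟩
    m * m * m * m                               ≡⟨ *-assoc (m * m) m m ⟩
    m * m * (m * m)                             ∎
    where
    open ≤-Reasoning
    Q : ℕ
    Q = suc X
    factor : ∀ m p → m * p * (m * p) * (m * p) + m * m * (m * p) ≡ m * m * m * (p * p * p + p)
    factor = solve-∀

  -- Adding m⁴(X + m²) to the hypothesis and cancelling m² turns it into m²X² + m²(X + m²) ≤ Q²(X + m²),
  -- that is, m⁴ ≤ Q²X + m²Q.
  second-moment-contradiction : ∀ {p m Q X K} → suc X ≡ Q → Q ≤ m * p → p * p * p + p ≤ m →
    m * m + K ≡ Q * Q → ¬ (m * m * X * (m * m * X) ≤ K * (m * m * (X + m * m)))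
  second-moment-contradiction {m = zero} ≡.refl ()
  second-moment-contradiction {m = m@(suc _)} {X = X} {K = K} ≡.refl Q≤mp m≥p³+p mm+K≡QQ bound =
    <-irrefl ≡.refl (begin-strict
      Q * Q * (m * m * T)                           ≡⟨ regroup Q m T ⟩
      m * m * (Q * Q * T)                           <⟨ *-monoʳ-< (m * m) cancelled ⟩
      m * m * (m * m * (X * X) + m * m * T)         ≡⟨ expand m X T ⟩
      m * m * X * (m * m * X) + m * m * (m * m * T) ≤⟨ +-monoˡ-≤ (m * m * (m * m * T)) bound ⟩
      K * (m * m * T) + m * m * (m * m * T)         ≡⟨ +-comm (K * (m * m * T)) (m * m * (m * m * T)) ⟩
      m * m * (m * m * T) + K * (m * m * T)         ≡⟨ *-distribʳ-+ (m * m * T) (m * m) K ⟨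
      (m * m + K) * (m * m * T)                     ≡⟨ ≡.cong (_* (m * m * T)) mm+K≡QQ ⟩
      Q * Q * (m * m * T)                           ∎)
    where
    open ≤-Reasoning
    Q T : ℕ
    Q = suc X
    T = X + m * m
    regroup : ∀ q m t → q * q * (m * m * t) ≡ m * m * (q * q * t)
    regroup = solve-∀
    expand : ∀ m x t → m * m * (m * m * (x * x) + m * m * t) ≡ m * m * x * (m * m * x) + m * m * (m * m * t)
    expand = solve-∀
    balance : ∀ x mm → (1 + x) * (1 + x) * (x + mm) + mm * mm ≡
                       (mm * (x * x) + mm * (x + mm)) + ((1 + x) * (1 + x) * x + mm * (1 + x))
    balance = solve-∀
    cancelled : Q * Q * T < m * m * (X * X) + m * m * T
    cancelled = +-cancelʳ-< (m * m * (m * m)) (Q * Q * T) (m * m * (X * X) + m * m * T) (begin-strict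
      Q * Q * T + m * m * (m * m)
        ≡⟨ balance X (m * m) ⟩
      (m * m * (X * X) + m * m * T) + (Q * Q * X + m * m * Q)
        <⟨ +-monoʳ-< (m * m * (X * X) + m * m * T) (Q²X+m²Q<m⁴ Q≤mp m≥p³+p) ⟩
      (m * m * (X * X) + m * m * T) + m * m * (m * m)
        ∎)

module FiniteField {c ℓ} (R : CommutativeRing c ℓ) (isField : IsField R) {n : ℕ} (card : HasCardinality R n) where

  open CommutativeRing R
  open import Algebra.Definitions.RawSemiring (Semiring.rawSemiring semiring) using (_^_)
  open import Algebra.Properties.Ring ring using (x[y-z]≈xy-xz; [y-z]x≈yx-zx; -1*x≈-x)
  open import Algebra.Properties.Semiring.Exp semiring using (^-congˡ)
  open import Algebra.Properties.CommutativeSemiring.Exp commutativeSemiring using (^-distrib-*)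
  open import Algebra.Properties.CommutativeSemigroup *-commutativeSemigroup using (interchange)
  open import Algebra.Properties.AbelianGroup +-abelianGroup
    using (⁻¹-anti-homo‿-; //-rightDividesˡ; \\-leftDividesʳ; x∙y⁻¹≈ε⇒x≈y; x≈y⇒x∙y⁻¹≈ε;
           ⁻¹-injective; ε⁻¹≈ε)
  module ≈-Reasoning = Relation.Binary.Reasoning.Setoid setoid
  open Counting
  open FiniteSetoid setoid card public

  1≉0 : ¬ 1# ≈ 0#
  1≉0 = proj₁ isField

  *-cancelˡ : ∀ {x y z} → ¬ x ≈ 0# → x * y ≈ x * z → y ≈ z
  *-cancelˡ {x} {y} {z} x≉0 xy≈xz with proj₂ isField x x≉0
  ... | x⁻¹ , xx⁻¹≈1 = begin
    y              ≈⟨ *-identityˡ y ⟨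
    1# * y         ≈⟨ *-congʳ (trans (*-comm x⁻¹ x) xx⁻¹≈1) ⟨
    (x⁻¹ * x) * y  ≈⟨ *-assoc x⁻¹ x y ⟩
    x⁻¹ * (x * y)  ≈⟨ *-congˡ xy≈xz ⟩
    x⁻¹ * (x * z)  ≈⟨ *-assoc x⁻¹ x z ⟨
    (x⁻¹ * x) * z  ≈⟨ *-congʳ (trans (*-comm x⁻¹ x) xx⁻¹≈1) ⟩
    1# * z         ≈⟨ *-identityˡ z ⟩
    z              ∎
    where open ≈-Reasoning

  *-cancelʳ : ∀ {x y z} → ¬ z ≈ 0# → x * z ≈ y * z → x ≈ y
  *-cancelʳ {x} {y} {z} z≉0 xz≈yz = *-cancelˡ z≉0 (trans (*-comm z x) (trans xz≈yz (*-comm y z)))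

  x*y≈0⇒x≈0⊎y≈0 : ∀ {x y} → x * y ≈ 0# → x ≈ 0# ⊎ y ≈ 0#
  x*y≈0⇒x≈0⊎y≈0 {x} xy≈0 with x ≟ 0#
  ... | yes x≈0 = inj₁ x≈0
  ... | no x≉0 = inj₂ (*-cancelˡ x≉0 (trans xy≈0 (sym (zeroʳ x))))

  x≈[x*y]*z : ∀ {x y z} → y * z ≈ 1# → x ≈ (x * y) * z
  x≈[x*y]*z {x} {y} {z} yz≈1 = sym (trans (*-assoc x y z) (trans (*-congˡ yz≈1) (*-identityʳ x)))

  1^n≈1 : ∀ k → 1# ^ k ≈ 1#
  1^n≈1 zero = refl
  1^n≈1 (suc k) = trans (*-identityˡ _) (1^n≈1 k)

  telescope : ∀ x y z → (x - y) + (y - z) ≈ x - z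
  telescope x y z = begin
    (x - y) + (y - z)   ≈⟨ +-assoc x (- y) (y - z) ⟩
    x + (- y + (y - z)) ≈⟨ +-congˡ (\\-leftDividesʳ y (- z)) ⟩
    x - z               ∎
    where open ≈-Reasoning

  1-[1-x]≈x : ∀ x → 1# - (1# - x) ≈ x
  1-[1-x]≈x x =
    trans (+-congˡ (⁻¹-anti-homo‿- 1# x)) (trans (+-comm 1# (x - 1#)) (//-rightDividesˡ 1# x))

  1-xu≈[1-x]v⇒x[u-v]≈1-v : ∀ {x u v} → 1# - x * u ≈ (1# - x) * v → x * (u - v) ≈ 1# - v
  1-xu≈[1-x]v⇒x[u-v]≈1-v {x} {u} {v} eq = begin
    x * (u - v)                ≈⟨ x[y-z]≈xy-xz x u v ⟩
    x * u - x * v              ≈⟨ telescope (x * u) v (x * v) ⟨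
    (x * u - v) + (v - x * v)  ≈⟨ +-congˡ v-xv≈1-xu ⟩
    (x * u - v) + (1# - x * u) ≈⟨ +-comm (x * u - v) (1# - x * u) ⟩
    (1# - x * u) + (x * u - v) ≈⟨ telescope 1# (x * u) v ⟩
    1# - v                     ∎
    where
    open ≈-Reasoning
    v-xv≈1-xu : v - x * v ≈ 1# - x * u
    v-xv≈1-xu = sym (trans eq (trans ([y-z]x≈yx-zx v 1# x) (+-congʳ (*-identityˡ v))))

  nonzero? : ∀ x → Dec (¬ x ≈ 0#)
  nonzero? x = ¬? (x ≟ 0#)

  count-nonzero : suc (count nonzero?) ≡ n
  count-nonzero = begin
    suc (count nonzero?)
      ≡⟨ ≡.cong (ℕ._+ count nonzero?) (count-≈ 0#) ⟨
    count (_≟ 0#) ℕ.+ count nonzero?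
      ≡⟨ ∑-+ (λ x → 𝟙 (x ≟ 0#)) (λ x → 𝟙 (nonzero? x)) ⟨
    ∑ (λ x → 𝟙 (x ≟ 0#) ℕ.+ 𝟙 (nonzero? x))
      ≡⟨ ∑-cong (λ x → 𝟙-split (yes tt) (x ≟ 0#) (λ _ → tt)) ⟩
    ∑ (λ _ → 1)
      ≡⟨ ∑-1 ⟩
    n ∎
    where open ≡.≡-Reasoning

  ≉0,1? : ∀ x → Dec (¬ x ≈ 0# × ¬ 1# - x ≈ 0#)
  ≉0,1? x = nonzero? x ×-dec nonzero? (1# - x)

  count-≉0,1 : suc (count ≉0,1?) ≡ count nonzero?
  count-≉0,1 = begin
    suc (count ≉0,1?)                      ≡⟨ ≡.cong (ℕ._+ count ≉0,1?) (count-≈ 1#) ⟨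
    count (_≟ 1#) ℕ.+ count ≉0,1?          ≡⟨ ∑-+ (λ x → 𝟙 (x ≟ 1#)) (λ x → 𝟙 (≉0,1? x)) ⟨
    ∑ (λ x → 𝟙 (x ≟ 1#) ℕ.+ 𝟙 (≉0,1? x))   ≡⟨ ∑-cong split ⟩
    count nonzero?                         ∎
    where
    open ≡.≡-Reasoning
    1-x≈0⇒x≈1 : ∀ {x} → 1# - x ≈ 0# → x ≈ 1#
    1-x≈0⇒x≈1 {x} 1-x≈0 = sym (x∙y⁻¹≈ε⇒x≈y 1# x 1-x≈0)
    x≈1⇒1-x≈0 : ∀ {x} → x ≈ 1# → 1# - x ≈ 0#
    x≈1⇒1-x≈0 x≈1 = x≈y⇒x∙y⁻¹≈ε (sym x≈1)
    split : ∀ x → 𝟙 (x ≟ 1#) ℕ.+ 𝟙 (≉0,1? x) ≡ 𝟙 (nonzero? x)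
    split x = ≡.trans
      (≡.cong (𝟙 (x ≟ 1#) ℕ.+_) (𝟙-cong (≉0,1? x) (nonzero? x ×-dec ¬? (x ≟ 1#))
        (λ (x≉0 , 1-x≉0) → x≉0 , 1-x≉0 ∘ x≈1⇒1-x≈0)
        (λ (x≉0 , x≉1) → x≉0 , x≉1 ∘ 1-x≈0⇒x≈1)))
      (𝟙-split (nonzero? x) (x ≟ 1#) (λ x≈1 x≈0 → 1≉0 (trans (sym x≈1) x≈0)))

  -- A polynomial of degree at most d is the vector of its d + 1 coefficients, constant term first.
  eval : ∀ {k} → Vec Carrier k → Carrier → Carrier
  eval [] _ = 0#
  eval (a ∷ f) x = a + x * eval f x

  eval-cong : ∀ {k} (f : Vec Carrier k) {x y} → x ≈ y → eval f x ≈ eval f y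
  eval-cong [] _ = refl
  eval-cong (a ∷ f) x≈y = +-congˡ (*-cong x≈y (eval-cong f x≈y))

  divide : ∀ {k} → Carrier → Vec Carrier (suc k) → Vec Carrier k
  divide _ (_ ∷ []) = []
  divide r (a ∷ f@(_ ∷ _)) = eval f r ∷ divide r f

  eval-divide : ∀ {k} r (f : Vec Carrier (suc k)) x → eval f x ≈ eval f r + (x - r) * eval (divide r f) x
  eval-divide r (a ∷ []) x = begin
    a + x * 0#                  ≈⟨ +-congˡ (zeroʳ x) ⟩
    a + 0#                      ≈⟨ +-congˡ (zeroʳ r) ⟨
    a + r * 0#                  ≈⟨ +-identityʳ (a + r * 0#) ⟨
    (a + r * 0#) + 0#           ≈⟨ +-congˡ (zeroʳ (x - r)) ⟨
    (a + r * 0#) + (x - r) * 0# ∎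
    where open ≈-Reasoning
  eval-divide r (a ∷ f@(_ ∷ _)) x = begin
    a + x * eval f x                    ≈⟨ +-congˡ (*-congˡ (eval-divide r f x)) ⟩
    a + x * (g + d * q)                 ≈⟨ +-congˡ (distribˡ x g (d * q)) ⟩
    a + (x * g + x * (d * q))           ≈⟨ +-congˡ (+-cong (*-congʳ r+d≈x) (sym x[dq]≈d[xq])) ⟨
    a + ((r + d) * g + d * (x * q))     ≈⟨ +-congˡ (+-congʳ (distribʳ g r d)) ⟩
    a + ((r * g + d * g) + d * (x * q)) ≈⟨ +-congˡ (+-assoc (r * g) (d * g) (d * (x * q))) ⟩
    a + (r * g + (d * g + d * (x * q))) ≈⟨ +-assoc a (r * g) (d * g + d * (x * q)) ⟨
    (a + r * g) + (d * g + d * (x * q)) ≈⟨ +-congˡ (distribˡ d g (x * q)) ⟨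
    (a + r * g) + d * (g + x * q)       ∎
    where
    open ≈-Reasoning
    g q d : Carrier
    g = eval f r
    q = eval (divide r f) x
    d = x - r
    r+d≈x : r + d ≈ x
    r+d≈x = trans (+-comm r d) (//-rightDividesˡ r x)
    x[dq]≈d[xq] : x * (d * q) ≈ d * (x * q)
    x[dq]≈d[xq] = trans (sym (*-assoc x d q)) (trans (*-congʳ (*-comm x d)) (*-assoc d x q))

  roots : ∀ {k} → Vec Carrier k → ℕ
  roots f = count (λ x → eval f x ≟ 0#)

  roots≤degree : ∀ {d} (f : Vec Carrier (suc d)) {x₀} → ¬ eval f x₀ ≈ 0# → roots f ≤ d
  roots≤degree {zero} (a ∷ []) {x₀} f[x₀]≉0 =
    ≤-reflexive (count-∅ (λ x → eval (a ∷ []) x ≟ 0#)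
                         (λ x f[x]≈0 → f[x₀]≉0 (trans (constant x₀) (trans (sym (constant x)) f[x]≈0))))
    where
    constant : ∀ x → eval (a ∷ []) x ≈ a
    constant x = trans (+-congˡ (zeroʳ x)) (+-identityʳ a)
  roots≤degree {suc d} f {x₀} f[x₀]≉0
    with any? (λ x≈y f[x]≈0 → trans (eval-cong f (sym x≈y)) f[x]≈0) (λ x → eval f x ≟ 0#)
  ... | no ∄root =
    ≤-trans (≤-reflexive (count-∅ (λ x → eval f x ≟ 0#) (λ x f[x]≈0 → ∄root (x , f[x]≈0)))) z≤n
  ... | yes (r , f[r]≈0) = begin
    roots f
      ≤⟨ ∑-mono-≤ (λ x → 𝟙-⊎ (eval f x ≟ 0#) (x ≟ r) (eval q x ≟ 0#) (root-of-factor x)) ⟩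
    ∑ (λ x → 𝟙 (x ≟ r) ℕ.+ 𝟙 (eval q x ≟ 0#))
      ≡⟨ ∑-+ (λ x → 𝟙 (x ≟ r)) (λ x → 𝟙 (eval q x ≟ 0#)) ⟩
    count (_≟ r) ℕ.+ roots q                  ≡⟨ ≡.cong (ℕ._+ roots q) (count-≈ r) ⟩
    suc (roots q)                             ≤⟨ s≤s (roots≤degree q q[x₀]≉0) ⟩
    suc d                                     ∎
    where
    open ≤-Reasoning
    q : Vec Carrier (suc d)
    q = divide r f
    factor : ∀ x → eval f x ≈ (x - r) * eval q x
    factor x = trans (eval-divide r f x) (trans (+-congʳ f[r]≈0) (+-identityˡ _))
    q[x₀]≉0 : ¬ eval q x₀ ≈ 0#
    q[x₀]≉0 q[x₀]≈0 = f[x₀]≉0 (trans (factor x₀) (trans (*-congˡ q[x₀]≈0) (zeroʳ _)))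
    root-of-factor : ∀ x → eval f x ≈ 0# → x ≈ r ⊎ eval q x ≈ 0#
    root-of-factor x f[x]≈0 with x*y≈0⇒x≈0⊎y≈0 (trans (sym (factor x)) f[x]≈0)
    ... | inj₁ x-r≈0 = inj₁ (x∙y⁻¹≈ε⇒x≈y x r x-r≈0)
    ... | inj₂ q[x]≈0 = inj₂ q[x]≈0

  monomial : ∀ k → Vec Carrier (suc k)
  monomial zero = 1# ∷ []
  monomial (suc k) = 0# ∷ monomial k

  eval-monomial : ∀ k x → eval (monomial k) x ≈ x ^ k
  eval-monomial zero x = trans (+-congˡ (zeroʳ x)) (+-identityʳ 1#)
  eval-monomial (suc k) x = trans (+-identityˡ _) (*-congˡ (eval-monomial k x))

  count[u^p≈h]≤p : ∀ p .{{_ : ℕ.NonZero p}} {h} → ¬ h ≈ 0# → count (λ u → u ^ p ≟ h) ≤ p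
  count[u^p≈h]≤p (suc p) {h} h≉0 =
    ≤-trans (count-mono (λ u → u ^ suc p ≟ h) (λ u → eval f u ≟ 0#) root) (roots≤degree f f[0]≉0)
    where
    f : Vec Carrier (suc (suc p))
    f = - h ∷ monomial p
    root : ∀ {u} → u ^ suc p ≈ h → eval f u ≈ 0#
    root {u} u^p≈h = trans (+-congˡ (trans (*-congˡ (eval-monomial p u)) u^p≈h)) (-‿inverseˡ h)
    -h≈f[0] : - h ≈ eval f 0#
    -h≈f[0] = sym (trans (+-congˡ (zeroˡ _)) (+-identityʳ (- h)))
    f[0]≉0 : ¬ eval f 0# ≈ 0#
    f[0]≉0 f[0]≈0 = h≉0 (⁻¹-injective (trans (trans -h≈f[0] f[0]≈0) (sym ε⁻¹≈ε)))

  unit⇒≉0 : ∀ {u} → IsUnit R u → ¬ u ≈ 0#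
  unit⇒≉0 (v , uv≈1) u≈0 = 1≉0 (trans (sym uv≈1) (trans (*-congʳ u≈0) (zeroˡ v)))

  unit? : ∀ u → Dec (IsUnit R u)
  unit? u = map′ (proj₂ isField u) unit⇒≉0 (nonzero? u)

  module UnitPowers (p : ℕ) where

    unitPower-resp : IsUnitPower R p Respects _≈_
    unitPower-resp x≈y (u , u-unit , u^p≈x) = u , u-unit , trans u^p≈x x≈y

    unitPower? : Decidable (IsUnitPower R p)
    unitPower? x = any? resp (λ u → unit? u ×-dec (u ^ p ≟ x))
      where
      resp : (λ u → IsUnit R u × u ^ p ≈ x) Respects _≈_
      resp u≈u′ ((v , uv≈1) , u^p≈x) =
        (v , trans (*-congʳ (sym u≈u′)) uv≈1) , trans (^-congˡ p (sym u≈u′)) u^p≈x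

    unitPower-* : ∀ {x y} → IsUnitPower R p x → IsUnitPower R p y → IsUnitPower R p (x * y)
    unitPower-* (u , (u′ , uu′≈1) , u^p≈x) (v , (v′ , vv′≈1) , v^p≈y) =
      u * v , (u′ * v′ , trans (interchange u v u′ v′) (trans (*-cong uu′≈1 vv′≈1) (*-identityʳ 1#))) ,
      trans (^-distrib-* u v p) (*-cong u^p≈x v^p≈y)

    unitPower-inverse : ∀ {x} → IsUnitPower R p x → ∃ λ y → IsUnitPower R p y × x * y ≈ 1#
    unitPower-inverse {x} (u , (u′ , uu′≈1) , u^p≈x) =
      u′ ^ p , (u′ , (u , trans (*-comm u′ u) uu′≈1) , refl) , (begin
        x * u′ ^ p       ≈⟨ *-congʳ u^p≈x ⟨
        u ^ p * u′ ^ p   ≈⟨ ^-distrib-* u u′ p ⟨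
        (u * u′) ^ p     ≈⟨ ^-congˡ p uu′≈1 ⟩
        1# ^ p           ≈⟨ 1^n≈1 p ⟩
        1#               ∎)
      where open ≈-Reasoning

    unitPower⇒≉0 : ∀ {x} → IsUnitPower R p x → ¬ x ≈ 0#
    unitPower⇒≉0 H[x] with unitPower-inverse H[x]
    ... | y , _ , xy≈1 = unit⇒≉0 (y , xy≈1)

    count-nonzero≤count-unitPower*p : .{{_ : ℕ.NonZero p}} → count nonzero? ≤ count unitPower? ℕ.* p
    count-nonzero≤count-unitPower*p = begin
      count nonzero?
        ≡⟨ count-fibres nonzero? (_^ p) ⟩
      ∑ (λ h → count (λ u → nonzero? u ×-dec (h ≟ u ^ p)))
        ≤⟨ ∑-mono-≤ fibre≤ ⟩
      ∑ (λ h → 𝟙 (unitPower? h) ℕ.* p)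
        ≡⟨ *-distribʳ-∑ p (λ h → 𝟙 (unitPower? h)) ⟨
      count unitPower? ℕ.* p ∎
      where
      open ≤-Reasoning
      fibre≤ : ∀ h → count (λ u → nonzero? u ×-dec (h ≟ u ^ p)) ≤ 𝟙 (unitPower? h) ℕ.* p
      fibre≤ h = bound (unitPower? h)
        where
        bound : (H[h]? : Dec (IsUnitPower R p h)) →
          count (λ u → nonzero? u ×-dec (h ≟ u ^ p)) ≤ 𝟙 H[h]? ℕ.* p
        bound (yes H[h]) =
          ≤-trans (count-mono (λ u → nonzero? u ×-dec (h ≟ u ^ p)) (λ u → u ^ p ≟ h) (sym ∘ proj₂))
                  (≤-trans (count[u^p≈h]≤p p (unitPower⇒≉0 H[h]))
                           (≤-reflexive (≡.sym (ℕₚ.+-identityʳ p))))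
        bound (no ¬H[h]) = ≤-reflexive (count-∅ (λ u → nonzero? u ×-dec (h ≟ u ^ p))
                                          (λ u (u≉0 , h≈u^p) → ¬H[h] (u , proj₂ isField u u≉0 , sym h≈u^p)))

    Adj⇒≉ : ∀ {x y} → Adj R p x y → ¬ x ≈ y
    Adj⇒≉ x~y x≈y = unitPower⇒≉0 x~y (x≈y⇒x∙y⁻¹≈ε x≈y)

    adjacent⇒InducesK3 : ∀ {x y z} → Adj R p x y → Adj R p x z → Adj R p y z → InducesK3 R p x y z
    adjacent⇒InducesK3 x~y x~z y~z = Adj⇒≉ x~y , Adj⇒≉ x~z , Adj⇒≉ y~z , x~y , x~z , y~z

    triangle : ∀ {x} → IsUnitPower R p (- 1#) → IsUnitPower R p x → IsUnitPower R p (1# - x) →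
      InducesK3 R p 0# 1# (1# - x)
    triangle {x} H[-1] H[x] H[1-x] = adjacent⇒InducesK3
      (unitPower-resp (sym (+-identityˡ (- 1#))) H[-1])
      (unitPower-resp (trans (-1*x≈-x (1# - x)) (sym (+-identityˡ (- (1# - x)))))
                      (unitPower-* H[-1] H[1-x]))
      (unitPower-resp (sym (1-[1-x]≈x x)) H[x])

  module Cosets {h} {H : Pred Carrier h} (H? : Decidable H) (H-resp : H Respects _≈_)
    (H⇒≉0 : ∀ {x} → H x → ¬ x ≈ 0#) (H-* : ∀ {x y} → H x → H y → H (x * y))
    (H-inverse : ∀ {x} → H x → ∃ λ y → H y × x * y ≈ 1#)
    where

    m : ℕ
    m = count H?

    infix 4 _∈_·H _∈?_·H

    -- The condition x ≉ 0 discards the degenerate coset 0·H = {0}.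
    _∈_·H : Carrier → Carrier → Set (h ⊔ c ⊔ ℓ)
    a ∈ x ·H = ¬ x ≈ 0# × ∃ λ g → H g × a ≈ x * g

    _∈?_·H : ∀ a x → Dec (a ∈ x ·H)
    a ∈? x ·H = nonzero? x ×-dec any? resp (λ g → H? g ×-dec (a ≟ x * g))
      where
      resp : (λ g → H g × a ≈ x * g) Respects _≈_
      resp g≈g′ (H[g] , a≈xg) = H-resp g≈g′ H[g] , trans a≈xg (*-congˡ g≈g′)

    ∈·H-resp : ∀ {x} → (_∈ x ·H) Respects _≈_
    ∈·H-resp a≈b (x≉0 , g , H[g] , a≈xg) = x≉0 , g , H[g] , trans (sym a≈b) a≈xg

    ∈·H⇒≉0 : ∀ {a x} → a ∈ x ·H → ¬ a ≈ 0#
    ∈·H⇒≉0 (x≉0 , g , H[g] , a≈xg) a≈0 with x*y≈0⇒x≈0⊎y≈0 (trans (sym a≈xg) a≈0)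
    ... | inj₁ x≈0 = x≉0 x≈0
    ... | inj₂ g≈0 = H⇒≉0 H[g] g≈0

    ∈·H⇒H : ∀ {a x} → a ∈ x ·H → H a → H x
    ∈·H⇒H (_ , g , H[g] , a≈xg) H[a] with H-inverse H[g]
    ... | g′ , H[g′] , gg′≈1 = H-resp (sym (trans (x≈[x*y]*z gg′≈1) (*-congʳ (sym a≈xg)))) (H-* H[a] H[g′])

    coset-overlap : ∀ {a x y} → a ∈ x ·H → a ∈ y ·H → y ∈ x ·H
    coset-overlap {a} {x} {y} (x≉0 , g , H[g] , a≈xg) (_ , k , H[k] , a≈yk) with H-inverse H[k]
    ... | k′ , H[k′] , kk′≈1 = x≉0 , g * k′ , H-* H[g] H[k′] , (begin
      y             ≈⟨ x≈[x*y]*z kk′≈1 ⟩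
      (y * k) * k′  ≈⟨ *-congʳ a≈yk ⟨
      a * k′        ≈⟨ *-congʳ a≈xg ⟩
      (x * g) * k′  ≈⟨ *-assoc x g k′ ⟩
      x * (g * k′)  ∎)
      where open ≈-Reasoning

    count-coset : ∀ x → count (_∈? x ·H) ≡ 𝟙 (nonzero? x) ℕ.* m
    count-coset x = size (nonzero? x)
      where
      size : (x≉0? : Dec (¬ x ≈ 0#)) → count (_∈? x ·H) ≡ 𝟙 x≉0? ℕ.* m
      size (no ¬x≉0) = count-∅ (_∈? x ·H) (λ _ (x≉0 , _) → ¬x≉0 x≉0)
      size (yes x≉0) = ≡.trans (ℕₚ.≤-antisym
        (count-≤-via-injection (_∈? x ·H) H? (λ a g → a ≟ x * g) H-resp
          (λ g≈g′ a≈xg → trans a≈xg (*-congˡ g≈g′)) (λ (_ , g , H[g] , a≈xg) → g , H[g] , a≈xg)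
          (λ a≈xg a′≈xg → trans a≈xg (sym a′≈xg)))
        (count-≤-via-injection H? (_∈? x ·H) (λ g a → a ≟ x * g) ∈·H-resp
          (λ a≈b a≈xg → trans (sym a≈b) a≈xg) (λ {g} H[g] → x * g , (x≉0 , g , H[g] , refl) , refl)
          (λ a≈xg a≈xg′ → *-cancelˡ x≉0 (trans (sym a≈xg) a≈xg′))))
        (≡.sym (ℕₚ.+-identityʳ m))

    count-meet : ∀ x y → count (λ a → a ∈? x ·H ×-dec a ∈? y ·H) ≤ 𝟙 (y ∈? x ·H) ℕ.* m
    count-meet x y = bound (y ∈? x ·H)
      where
      bound : (y∈?xH : Dec (y ∈ x ·H)) → count (λ a → a ∈? x ·H ×-dec a ∈? y ·H) ≤ 𝟙 y∈?xH ℕ.* m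
      bound (yes _) = begin
        count (λ a → a ∈? x ·H ×-dec a ∈? y ·H)
          ≤⟨ count-mono (λ a → a ∈? x ·H ×-dec a ∈? y ·H) (_∈? x ·H) proj₁ ⟩
        count (_∈? x ·H)      ≡⟨ count-coset x ⟩
        𝟙 (nonzero? x) ℕ.* m  ≤⟨ ℕₚ.*-monoˡ-≤ m (𝟙≤1 (nonzero? x)) ⟩
        1 ℕ.* m               ∎
        where open ≤-Reasoning
      bound (no y∉xH) = ≤-reflexive (count-∅ (λ a → a ∈? x ·H ×-dec a ∈? y ·H)
                                       (λ a (a∈xH , a∈yH) → y∉xH (coset-overlap a∈xH a∈yH)))

    -- As a ∈ x·H iff x ∈ a·H, this is the cyclotomic number #{x ∈ a·H : 1 - x ∈ b·H}.
    cyclotomic : Carrier → Carrier → ℕ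
    cyclotomic a b = count (λ x → a ∈? x ·H ×-dec b ∈? (1# - x) ·H)

    ∑-cyclotomic : ∑₂ cyclotomic ≡ m ℕ.* m ℕ.* count ≉0,1?
    ∑-cyclotomic = begin
      ∑₂ cyclotomic
        ≡⟨ ∑₂-swap-∑ (λ a b x → 𝟙 (a ∈? x ·H ×-dec b ∈? (1# - x) ·H)) ⟩
      ∑ (λ x → ∑₂ (λ a b → 𝟙 (a ∈? x ·H ×-dec b ∈? (1# - x) ·H)))
        ≡⟨ ∑-cong (λ x → ∑₂-cong (λ a b → 𝟙-× (a ∈? x ·H) (b ∈? (1# - x) ·H))) ⟩
      ∑ (λ x → ∑₂ (λ a b → 𝟙 (a ∈? x ·H) ℕ.* 𝟙 (b ∈? (1# - x) ·H)))
        ≡⟨ ∑-cong (λ x → ∑*∑ (λ a → 𝟙 (a ∈? x ·H)) (λ b → 𝟙 (b ∈? (1# - x) ·H))) ⟨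
      ∑ (λ x → count (_∈? x ·H) ℕ.* count (_∈? (1# - x) ·H))
        ≡⟨ ∑-cong (λ x → ≡.cong₂ ℕ._*_ (count-coset x) (count-coset (1# - x))) ⟩
      ∑ (λ x → 𝟙 (nonzero? x) ℕ.* m ℕ.* (𝟙 (nonzero? (1# - x)) ℕ.* m))
        ≡⟨ ∑-cong (λ x → ≡.trans ([am][bm]≡mm[ab] (𝟙 (nonzero? x)) (𝟙 (nonzero? (1# - x))) m)
                                   (≡.cong (m ℕ.* m ℕ.*_) (≡.sym (𝟙-× (nonzero? x) (nonzero? (1# - x)))))) ⟩
      ∑ (λ x → m ℕ.* m ℕ.* 𝟙 (≉0,1? x))
        ≡⟨ *-distribˡ-∑ (m ℕ.* m) (λ x → 𝟙 (≉0,1? x)) ⟨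
      m ℕ.* m ℕ.* count ≉0,1? ∎
      where open ≡.≡-Reasoning

    linked? : ∀ x y → Dec (y ∈ x ·H × 1# - y ∈ (1# - x) ·H)
    linked? x y = y ∈? x ·H ×-dec 1# - y ∈? (1# - x) ·H

    ∑-cyclotomic² :
      ∑₂ (λ a b → cyclotomic a b ℕ.* cyclotomic a b) ≤ m ℕ.* m ℕ.* ∑₂ (λ x y → 𝟙 (linked? x y))
    ∑-cyclotomic² = begin
      ∑₂ (λ a b → cyclotomic a b ℕ.* cyclotomic a b)
        ≡⟨ ∑₂-cong (λ a b → ∑*∑ (t a b) (t a b)) ⟩
      ∑₂ (λ a b → ∑₂ (λ x y → t a b x ℕ.* t a b y))
        ≡⟨ ∑₂-swap (λ a b x y → t a b x ℕ.* t a b y) ⟩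
      ∑₂ (λ x y → ∑₂ (λ a b → t a b x ℕ.* t a b y))
        ≡⟨ ∑₂-cong (λ x y → ∑₂-cong (λ a b → regroup a b x y)) ⟩
      ∑₂ (λ x y → ∑₂ (λ a b → meet x y a ℕ.* meet (1# - x) (1# - y) b))
        ≡⟨ ∑₂-cong (λ x y → ∑*∑ (meet x y) (meet (1# - x) (1# - y))) ⟨
      ∑₂ (λ x y → ∑ (meet x y) ℕ.* ∑ (meet (1# - x) (1# - y)))
        ≤⟨ ∑₂-mono-≤ (λ x y → ℕₚ.*-mono-≤ (count-meet x y) (count-meet (1# - x) (1# - y))) ⟩
      ∑₂ (λ x y → 𝟙 (y ∈? x ·H) ℕ.* m ℕ.* (𝟙 (1# - y ∈? (1# - x) ·H) ℕ.* m))
        ≡⟨ ∑₂-cong (λ x y →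
             ≡.trans ([am][bm]≡mm[ab] (𝟙 (y ∈? x ·H)) (𝟙 (1# - y ∈? (1# - x) ·H)) m)
                     (≡.cong (m ℕ.* m ℕ.*_) (≡.sym (𝟙-× (y ∈? x ·H) (1# - y ∈? (1# - x) ·H))))) ⟩
      ∑₂ (λ x y → m ℕ.* m ℕ.* 𝟙 (linked? x y))
        ≡⟨ *-distribˡ-∑₂ (m ℕ.* m) (λ x y → 𝟙 (linked? x y)) ⟨
      m ℕ.* m ℕ.* ∑₂ (λ x y → 𝟙 (linked? x y)) ∎
      where
      open ≤-Reasoning
      t : Carrier → Carrier → Carrier → ℕ
      t a b x = 𝟙 (a ∈? x ·H ×-dec b ∈? (1# - x) ·H)
      meet : Carrier → Carrier → Carrier → ℕ
      meet x y a = 𝟙 (a ∈? x ·H ×-dec a ∈? y ·H)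
      regroup : ∀ a b x y → t a b x ℕ.* t a b y ≡ meet x y a ℕ.* meet (1# - x) (1# - y) b
      regroup a b x y = begin-equality
        t a b x ℕ.* t a b y
          ≡⟨ ≡.cong₂ ℕ._*_ (𝟙-× (a ∈? x ·H) (b ∈? (1# - x) ·H))
                           (𝟙-× (a ∈? y ·H) (b ∈? (1# - y) ·H)) ⟩
        𝟙 (a ∈? x ·H) ℕ.* 𝟙 (b ∈? (1# - x) ·H) ℕ.* (𝟙 (a ∈? y ·H) ℕ.* 𝟙 (b ∈? (1# - y) ·H))
          ≡⟨ [ab][cd]≡[ac][bd] (𝟙 (a ∈? x ·H)) (𝟙 (b ∈? (1# - x) ·H))
                               (𝟙 (a ∈? y ·H)) (𝟙 (b ∈? (1# - y) ·H)) ⟩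
        𝟙 (a ∈? x ·H) ℕ.* 𝟙 (a ∈? y ·H) ℕ.* (𝟙 (b ∈? (1# - x) ·H) ℕ.* 𝟙 (b ∈? (1# - y) ·H))
          ≡⟨ ≡.cong₂ ℕ._*_ (𝟙-× (a ∈? x ·H) (a ∈? y ·H))
                           (𝟙-× (b ∈? (1# - x) ·H) (b ∈? (1# - y) ·H)) ⟨
        meet x y a ℕ.* meet (1# - x) (1# - y) b ∎

    -- Off the diagonal, a linked pair (x, y) is recovered from u = y/x ∈ H ∖ {1} and the v ∈ H with
    -- 1 - xu = (1 - x)v, because x(u - v) = 1 - v and u ≠ v; so there are at most m² such pairs.
    LinkedRatio : Carrier → Carrier → Set (h ⊔ c ⊔ ℓ)
    LinkedRatio x u = H u × ¬ u ≈ 1# × 1# - x * u ∈ (1# - x) ·H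

    linked-ratio? : ∀ x u → Dec (LinkedRatio x u)
    linked-ratio? x u = H? u ×-dec ¬? (u ≟ 1#) ×-dec 1# - x * u ∈? (1# - x) ·H

    count-off-diagonal≤ : ∀ x → count (λ y → linked? x y ×-dec ¬? (y ≟ x)) ≤ count (linked-ratio? x)
    count-off-diagonal≤ x = count-≤-via-injection (λ y → linked? x y ×-dec ¬? (y ≟ x)) (linked-ratio? x)
      (λ y u → y ≟ x * u) ratio-resp (λ u≈u′ y≈xu → trans y≈xu (*-congˡ u≈u′)) ratio
      (λ y≈xu y′≈xu → trans y≈xu (sym y′≈xu))
      where
      ratio-resp : LinkedRatio x Respects _≈_
      ratio-resp u≈u′ (H[u] , u≉1 , 1-xu∈[1-x]H) =
        H-resp u≈u′ H[u] , (λ u′≈1 → u≉1 (trans u≈u′ u′≈1)) ,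
        ∈·H-resp (+-congˡ (-‿cong (*-congˡ u≈u′))) 1-xu∈[1-x]H
      ratio : ∀ {y} → (y ∈ x ·H × 1# - y ∈ (1# - x) ·H) × ¬ y ≈ x → ∃ λ u → LinkedRatio x u × y ≈ x * u
      ratio (((x≉0 , u , H[u] , y≈xu) , 1-y∈[1-x]H) , y≉x) =
        u , (H[u] , u≉1 , ∈·H-resp (+-congˡ (-‿cong y≈xu)) 1-y∈[1-x]H) , y≈xu
        where
        u≉1 : ¬ u ≈ 1#
        u≉1 u≈1 = y≉x (trans y≈xu (trans (*-congˡ u≈1) (*-identityʳ x)))

    count-diagonal : ∀ x → count (λ y → y ≟ x ×-dec ≉0,1? x) ≡ 𝟙 (≉0,1? x)
    count-diagonal x = begin
      ∑ (λ y → 𝟙 (y ≟ x ×-dec ≉0,1? x))    ≡⟨ ∑-cong (λ y → 𝟙-× (y ≟ x) (≉0,1? x)) ⟩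
      ∑ (λ y → 𝟙 (y ≟ x) ℕ.* 𝟙 (≉0,1? x))  ≡⟨ *-distribʳ-∑ (𝟙 (≉0,1? x)) (λ y → 𝟙 (y ≟ x)) ⟨
      count (_≟ x) ℕ.* 𝟙 (≉0,1? x)         ≡⟨ ≡.cong (ℕ._* 𝟙 (≉0,1? x)) (count-≈ x) ⟩
      1 ℕ.* 𝟙 (≉0,1? x)                    ≡⟨ ℕₚ.*-identityˡ (𝟙 (≉0,1? x)) ⟩
      𝟙 (≉0,1? x)                          ∎
      where open ≡.≡-Reasoning

    count-linked≤ : ∀ x → count (linked? x) ≤ 𝟙 (≉0,1? x) ℕ.+ count (linked-ratio? x)
    count-linked≤ x = begin
      count (linked? x)
        ≤⟨ ∑-mono-≤ (λ y → 𝟙-⊎ (linked? x y) (y ≟ x ×-dec ≉0,1? x) (linked? x y ×-dec ¬? (y ≟ x))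
                                 (diagonal-or-not y)) ⟩
      ∑ (λ y → 𝟙 (y ≟ x ×-dec ≉0,1? x) ℕ.+ 𝟙 (linked? x y ×-dec ¬? (y ≟ x)))
        ≡⟨ ∑-+ (λ y → 𝟙 (y ≟ x ×-dec ≉0,1? x)) (λ y → 𝟙 (linked? x y ×-dec ¬? (y ≟ x))) ⟩
      count (λ y → y ≟ x ×-dec ≉0,1? x) ℕ.+ count (λ y → linked? x y ×-dec ¬? (y ≟ x))
        ≤⟨ ℕₚ.+-mono-≤ (≤-reflexive (count-diagonal x)) (count-off-diagonal≤ x) ⟩
      𝟙 (≉0,1? x) ℕ.+ count (linked-ratio? x)
        ∎
      where
      open ≤-Reasoning
      diagonal-or-not : ∀ y → y ∈ x ·H × 1# - y ∈ (1# - x) ·H →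
        (y ≈ x × ¬ x ≈ 0# × ¬ 1# - x ≈ 0#) ⊎ ((y ∈ x ·H × 1# - y ∈ (1# - x) ·H) × ¬ y ≈ x)
      diagonal-or-not y linked@((x≉0 , _) , (1-x≉0 , _)) with y ≟ x
      ... | yes y≈x = inj₁ (y≈x , x≉0 , 1-x≉0)
      ... | no y≉x = inj₂ (linked , y≉x)

    count-ratio≤ : ∀ u → count (λ x → linked-ratio? x u) ≤ 𝟙 (H? u) ℕ.* m
    count-ratio≤ u = bound (H? u) (u ≟ 1#)
      where
      unique : ¬ u ≈ 1# → ∀ {x x′ v} → 1# - x * u ≈ (1# - x) * v → 1# - x′ * u ≈ (1# - x′) * v →
        x ≈ x′
      unique u≉1 {x} {v = v} eq eq′ =
        *-cancelʳ u-v≉0 (trans (1-xu≈[1-x]v⇒x[u-v]≈1-v eq) (sym (1-xu≈[1-x]v⇒x[u-v]≈1-v eq′)))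
        where
        u-v≉0 : ¬ u - v ≈ 0#
        u-v≉0 u-v≈0 = u≉1 (trans (x∙y⁻¹≈ε⇒x≈y u v u-v≈0) (sym (x∙y⁻¹≈ε⇒x≈y 1# v 1-v≈0)))
          where
          1-v≈0 : 1# - v ≈ 0#
          1-v≈0 = trans (sym (1-xu≈[1-x]v⇒x[u-v]≈1-v eq)) (trans (*-congˡ u-v≈0) (zeroʳ x))
      bound : (H[u]? : Dec (H u)) → Dec (u ≈ 1#) → count (λ x → linked-ratio? x u) ≤ 𝟙 H[u]? ℕ.* m
      bound (no ¬H[u]) _ = ≤-reflexive (count-∅ (λ x → linked-ratio? x u) (λ x (H[u] , _) → ¬H[u] H[u]))
      bound (yes _) (yes u≈1) =
        ≤-trans (≤-reflexive (count-∅ (λ x → linked-ratio? x u) (λ x (_ , u≉1 , _) → u≉1 u≈1))) z≤n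
      bound (yes _) (no u≉1) = ≤-trans
        (count-≤-via-injection (λ x → linked-ratio? x u) H? (λ x v → 1# - x * u ≟ (1# - x) * v) H-resp
          (λ v≈v′ eq → trans eq (*-congˡ v≈v′)) (λ (_ , _ , _ , v , H[v] , eq) → v , H[v] , eq)
          (unique u≉1))
        (≤-reflexive (≡.sym (ℕₚ.+-identityʳ m)))

    ∑-linked≤ : ∑₂ (λ x y → 𝟙 (linked? x y)) ≤ count ≉0,1? ℕ.+ m ℕ.* m
    ∑-linked≤ = begin
      ∑ (λ x → count (linked? x))
        ≤⟨ ∑-mono-≤ count-linked≤ ⟩
      ∑ (λ x → 𝟙 (≉0,1? x) ℕ.+ count (linked-ratio? x))
        ≡⟨ ∑-+ (λ x → 𝟙 (≉0,1? x)) (λ x → count (linked-ratio? x)) ⟩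
      count ≉0,1? ℕ.+ ∑ (λ x → count (linked-ratio? x))
        ≡⟨ ≡.cong (count ≉0,1? ℕ.+_) (∑-swap (λ x u → 𝟙 (linked-ratio? x u))) ⟩
      count ≉0,1? ℕ.+ ∑ (λ u → count (λ x → linked-ratio? x u))
        ≤⟨ ℕₚ.+-monoʳ-≤ (count ≉0,1?) (∑-mono-≤ count-ratio≤) ⟩
      count ≉0,1? ℕ.+ ∑ (λ u → 𝟙 (H? u) ℕ.* m)
        ≡⟨ ≡.cong (count ≉0,1? ℕ.+_) (*-distribʳ-∑ m (λ u → 𝟙 (H? u))) ⟨
      count ≉0,1? ℕ.+ m ℕ.* m ∎
      where open ≤-Reasoning

    support? : ∀ a b → Dec ((¬ a ≈ 0# × ¬ b ≈ 0#) × ¬ (H a × H b))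
    support? a b = (nonzero? a ×-dec nonzero? b) ×-dec ¬? (H? a ×-dec H? b)

    ∑-support : m ℕ.* m ℕ.+ ∑₂ (λ a b → 𝟙 (support? a b)) ≡ count nonzero? ℕ.* count nonzero?
    ∑-support = begin
      m ℕ.* m ℕ.+ ∑₂ (λ a b → 𝟙 (support? a b))
        ≡⟨ ≡.cong (ℕ._+ ∑₂ (λ a b → 𝟙 (support? a b))) (count²≡∑₂ H?) ⟩
      ∑₂ (λ a b → 𝟙 (H? a ×-dec H? b)) ℕ.+ ∑₂ (λ a b → 𝟙 (support? a b))
        ≡⟨ ∑₂-+ (λ a b → 𝟙 (H? a ×-dec H? b)) (λ a b → 𝟙 (support? a b)) ⟨
      ∑₂ (λ a b → 𝟙 (H? a ×-dec H? b) ℕ.+ 𝟙 (support? a b))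
        ≡⟨ ∑₂-cong (λ a b → 𝟙-split (nonzero? a ×-dec nonzero? b) (H? a ×-dec H? b)
                                    (λ (H[a] , H[b]) → H⇒≉0 H[a] , H⇒≉0 H[b])) ⟩
      ∑₂ (λ a b → 𝟙 (nonzero? a ×-dec nonzero? b))
        ≡⟨ count²≡∑₂ nonzero? ⟨
      count nonzero? ℕ.* count nonzero? ∎
      where
      open ≡.≡-Reasoning
      count²≡∑₂ : ∀ {p} {P : Pred Carrier p} (P? : Decidable P) →
        count P? ℕ.* count P? ≡ ∑₂ (λ a b → 𝟙 (P? a ×-dec P? b))
      count²≡∑₂ P? = ≡.trans (∑*∑ (λ a → 𝟙 (P? a)) (λ b → 𝟙 (P? b)))
                             (∑₂-cong (λ a b → ≡.sym (𝟙-× (P? a) (P? b))))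

    second-moment : (∀ x → H x → H (1# - x) → ⊥) →
      m ℕ.* m ℕ.* count ≉0,1? ℕ.* (m ℕ.* m ℕ.* count ≉0,1?) ≤
        ∑₂ (λ a b → 𝟙 (support? a b)) ℕ.* (m ℕ.* m ℕ.* (count ≉0,1? ℕ.+ m ℕ.* m))
    second-moment ∄x = begin
      m ℕ.* m ℕ.* count ≉0,1? ℕ.* (m ℕ.* m ℕ.* count ≉0,1?)
        ≡⟨ ≡.cong₂ ℕ._*_ ∑-cyclotomic ∑-cyclotomic ⟨
      ∑₂ cyclotomic ℕ.* ∑₂ cyclotomic
        ≤⟨ cauchy-schwarz cyclotomic (λ a b → 𝟙 (support? a b)) supported ⟩
      ∑₂ (λ a b → 𝟙 (support? a b)) ℕ.* ∑₂ (λ a b → cyclotomic a b ℕ.* cyclotomic a b)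
        ≤⟨ ℕₚ.*-monoʳ-≤ (∑₂ (λ a b → 𝟙 (support? a b)))
                        (≤-trans ∑-cyclotomic² (ℕₚ.*-monoʳ-≤ (m ℕ.* m) ∑-linked≤)) ⟩
      ∑₂ (λ a b → 𝟙 (support? a b)) ℕ.* (m ℕ.* m ℕ.* (count ≉0,1? ℕ.+ m ℕ.* m)) ∎
      where
      open ≤-Reasoning
      supported : ∀ a b → 𝟙 (support? a b) ≡ 0 → cyclotomic a b ≡ 0
      supported a b unsupported = count-∅ (λ x → a ∈? x ·H ×-dec b ∈? (1# - x) ·H)
        λ x (a∈xH , b∈[1-x]H) → 𝟙≡0⇒¬ (support? a b) unsupported
          ((∈·H⇒≉0 a∈xH , ∈·H⇒≉0 b∈[1-x]H) ,
           λ (H[a] , H[b]) → ∄x x (∈·H⇒H a∈xH H[a]) (∈·H⇒H b∈[1-x]H H[b]))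

open import Data.Nat using (_+_; _^_)
open Arithmetic

lemma3p8 : ∀ {c ℓ : Level} (R : CommutativeRing c ℓ) (p : ℕ) → Prime p →
    IsField R →
    (n : ℕ) → HasCardinality R n →
    (Σ ℕ λ ch → HasCharacteristic R ch × ¬ (ch ≡ p)) →
    IsUnitPower R p (CommutativeRing.-_ R (CommutativeRing.1# R)) →
    (p + 1) ^ 4 ≤ n →
    Σ (CommutativeRing.Carrier R) λ a →
      ¬ (CommutativeRing._≈_ R a (CommutativeRing.0# R)) ×
      ¬ (CommutativeRing._≈_ R a (CommutativeRing.1# R)) ×
      InducesK3 R p (CommutativeRing.0# R) (CommutativeRing.1# R) a
lemma3p8 _ zero prime[0] _ _ _ _ _ _ = ⊥-elim (¬prime[0] prime[0])
lemma3p8 {c} {ℓ} R (suc p) _ isField _ card _ H[-1] big =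
  witness (any? solution-resp (λ x → unitPower? x ×-dec unitPower? (1# - x)))
  where
  open CommutativeRing R using (Carrier; _≈_; 0#; 1#; _-_; sym; +-congˡ; -‿cong)
  open FiniteField R isField card
  open UnitPowers (suc p)
  open Cosets unitPower? unitPower-resp unitPower⇒≉0 unitPower-* unitPower-inverse
  Solution : Carrier → Set (c ⊔ ℓ)
  Solution x = IsUnitPower R (suc p) x × IsUnitPower R (suc p) (1# - x)
  solution-resp : ∀ {x y} → x ≈ y → Solution x → Solution y
  solution-resp x≈y (H[x] , H[1-x]) =
    unitPower-resp x≈y H[x] , unitPower-resp (+-congˡ (-‿cong x≈y)) H[1-x]
  witness : Dec (∃ Solution) → Σ Carrier λ a → ¬ a ≈ 0# × ¬ a ≈ 1# × InducesK3 R (suc p) 0# 1# a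
  witness (yes (x , H[x] , H[1-x])) with triangle H[-1] H[x] H[1-x]
  ... | K3@(_ , 0≉a , 1≉a , _) = 1# - x , (λ a≈0 → 0≉a (sym a≈0)) , (λ a≈1 → 1≉a (sym a≈1)) , K3
  witness (no ∄x) = ⊥-elim (second-moment-contradiction count-≉0,1 count-nonzero≤count-unitPower*p
    (p³+p≤m (suc p) m (count nonzero?) (≡.subst ((suc p + 1) ^ 4 ≤_) (≡.sym count-nonzero) big)
            count-nonzero≤count-unitPower*p)
    ∑-support (second-moment (λ x H[x] H[1-x] → ∄x (x , H[x] , H[1-x]))))
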